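{- Let $k\in\mathbb{Z}$, let $a\in\mathbb{C}$ with $a\neq 0$, and let $n\ge 0$. Then \[ PC_{n}^{(k)}(x:a)=\sum_{l=0}^{n}\frac{\binom{n}{l}\,C_{n-l}^{(k)}}{a^{n-l}}\,C_{l}(-x:a). \]
   Context: For an integer $k$, $\mathrm{Lif}_k(t)=\sum_{n=0}^{\infty}\frac{t^{n}}{n!\,(n+1)^{k}}$. The poly-Cauchy numbers of the first kind $C_n^{(k)}$ are defined by $\mathrm{Lif}_k(\log(1+t))=\sum_{n\ge0}C_n^{(k)}\frac{t^n}{n!}$. The Poisson-Charlier polynomials $C_n(x:a)$ ($a\neq0$) are defined by $e^{ -t}\left(1+\frac{t}{a}\right)^{x}=\sum_{n\ge0}C_n(x:a)\frac{t^n}{n!}$. For $a\neq0$, the polynomials $PC_n^{(k)}(x:a)$ are defined by $e^{ -t}\,\mathrm{Lif}_k\!\left(\log\left(1+\frac{t}{a}\right)\right)\left(1+\frac{t}{a}\right)^{ -x}=\sum_{n\ge0}PC_n^{(k)}(x:a)\frac{t^n}{n!}$. -}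

module Defs where

open import Level using (_⊔_)
open import Data.Nat as ℕ using (ℕ; zero; suc; _∸_)
open import Data.Nat.Combinatorics using (_C_)
open import Data.Nat.Base using (_!)
open import Data.Integer as ℤ using (ℤ; +_; -[1+_])
open import Relation.Nullary using (¬_)
open import Algebra.Bundles using (CommutativeRing; Semiring)
import Algebra.Definitions.RawSemiring as RS

record Char0Field (c ℓ : Level.Level) : Set (Level.suc (c ⊔ ℓ)) where
  field
    commutativeRing : CommutativeRing c ℓ
  open CommutativeRing commutativeRing public hiding (zero)
  open RS (Semiring.rawSemiring semiring) public using (_×_; _^_)
  field
    _⁻¹      : Carrier → Carrier
    ⁻¹-cong  : ∀ {y z} → y ≈ z → y ⁻¹ ≈ z ⁻¹
    inverse  : ∀ y → ¬ (y ≈ 0#) → y * (y ⁻¹) ≈ 1#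
    char0    : ∀ n → ¬ ((suc n × 1#) ≈ 0#)

-- Formal power series are represented by their EXPONENTIAL generating
-- coefficient sequences:  f : ℕ → A  stands for  Σ_n f n · t^n / n!.
module Series {c ℓ} (F : Char0Field c ℓ) where
  open Char0Field F

  ι : ℕ → Carrier
  ι n = n × 1#

  sumTo : ℕ → (ℕ → Carrier) → Carrier
  sumTo zero    f = f zero
  sumTo (suc n) f = sumTo n f + f (suc n)

  -- product of series (binomial convolution of EGF coefficients)
  _⊛_ : (ℕ → Carrier) → (ℕ → Carrier) → (ℕ → Carrier)
  (f ⊛ g) n = sumTo n (λ i → (n C i) × (f i * g (n ∸ i)))

  -- powDiv g m n = n-th EGF coefficient of g(t)^m / m!, for g with g 0 = 0,
  -- computed via (g^{m+1}/(m+1)!)' = g' · g^m/m!  and zero constant term.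
  powDiv : (ℕ → Carrier) → ℕ → ℕ → Carrier
  powDiv g zero    zero    = 1#
  powDiv g zero    (suc n) = 0#
  powDiv g (suc m) zero    = 0#
  powDiv g (suc m) (suc n) =
    sumTo n (λ j → (n C j) × (g (suc j) * powDiv g m (n ∸ j)))

  -- composition f(g(t)) for g with g 0 = 0:  Σ_m f_m g^m/m!
  -- (terms with m > n vanish in coefficient n)
  compose : (ℕ → Carrier) → (ℕ → Carrier) → (ℕ → Carrier)
  compose f g n = sumTo n (λ m → f m * powDiv g m n)

  -- Lif_k(t) = Σ t^n / (n! (n+1)^k): EGF coefficient 1/(n+1)^k
  lif : ℤ → ℕ → Carrier
  lif (+ j)     n = (ι (suc n) ^ j) ⁻¹
  lif -[1+ j ]  n = ι (suc n) ^ suc j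

  -- log(1 + b t) = Σ_{i≥0} (-1)^i b^{i+1} t^{i+1}/(i+1): EGF coefficients
  logSeries : Carrier → ℕ → Carrier
  logSeries b zero    = 0#
  logSeries b (suc i) = ((- 1#) ^ i) * (ι (i !) * (b ^ suc i))

  expNeg : ℕ → Carrier
  expNeg n = (- 1#) ^ n

  falling : Carrier → ℕ → Carrier
  falling y zero    = 1#
  falling y (suc n) = falling y n * (y - ι n)

  -- (1 + b t)^y = Σ binom(y,n) b^n t^n : EGF coefficient (y)_n b^n
  binomSeries : Carrier → Carrier → ℕ → Carrier
  binomSeries y b n = falling y n * (b ^ n)

  -- poly-Cauchy numbers of the first kind: Lif_k(log(1+t))
  polyCauchy : ℤ → ℕ → Carrier
  polyCauchy k = compose (lif k) (logSeries 1#)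

  -- Poisson-Charlier polynomials: e^{-t} (1 + t/a)^x
  poissonCharlier : Carrier → Carrier → ℕ → Carrier
  poissonCharlier x a = expNeg ⊛ binomSeries x (a ⁻¹)

  -- PC_n^{(k)}(x:a): e^{-t} Lif_k(log(1+t/a)) (1+t/a)^{-x}
  PC : ℤ → Carrier → Carrier → ℕ → Carrier
  PC k x a = expNeg ⊛ (compose (lif k) (logSeries (a ⁻¹)) ⊛ binomSeries (- x) (a ⁻¹))

module Submission where

-- Write L_a(t) = Lif_k(log(1 + t/a)),  E(t) = e^{-t}  and
-- B(t) = (1 + t/a)^{-x}.  By definition PC^{(k)}(x:a) = E·(L_a·B), and the
-- Poisson–Charlier series is C(-x:a) = E·B.  Hence, in the ring of
-- exponential generating series,
--     PC^{(k)}(x:a) = E·(L_a·B) = (E·B)·L_a = C(-x:a)·L_a ,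
-- and reading off the n-th coefficient of a product of EGFs gives the
-- binomial convolution  Σ_l (n C l) C_l(-x:a) [L_a]_{n-l}.  It remains to see
-- [L_a]_m = C_m^{(k)} / a^m: substituting t ↦ t/a scales the m-th
-- coefficient of any composite f(g(t)) by (1/a)^m, and (1/a)^m = 1/a^m.

open import Defs
open import Data.Nat using (ℕ; _∸_)
open import Data.Nat.Combinatorics using (_C_)
open import Data.Integer using (ℤ)
open import Relation.Nullary using (¬_)

open import Data.Nat as N using (zero; suc; z≤n; s≤s)
import Data.Nat.Properties as NP
import Data.Nat.Combinatorics as NC
open import Relation.Nullary using (yes; no)
import Relation.Binary.PropositionalEquality as PE
import Algebra.Properties.Monoid.Mult as MM
import Algebra.Properties.CommutativeMonoid.Mult as CMM
import Algebra.Properties.Semiring.Mult as SM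
import Algebra.Properties.Semiring.Exp as SE
import Algebra.Properties.CommutativeSemiring.Exp as CSE
import Algebra.Properties.CommutativeSemigroup as CSG
import Relation.Binary.Reasoning.Setoid as SR

module _ {c ℓ} (F : Char0Field c ℓ) where
  open Char0Field F
  open Series F
  open MM +-monoid using (×-congʳ; ×-homo-1; ×-homo-0; ×-homo-+)
  open CMM +-commutativeMonoid using (×-distrib-+)
  open SM semiring using (×-comm-*)
  open SE semiring using (^-homo-*; ^-congˡ; ^-congʳ)
  open CSE commutativeSemiring using (^-distrib-*)
  module A+ = CSG +-commutativeSemigroup
  module A* = CSG *-commutativeSemigroup
  open SR setoid

  sumTo-cong : ∀ n {f g : ℕ → Carrier} → (∀ i → i N.≤ n → f i ≈ g i) → sumTo n f ≈ sumTo n g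
  sumTo-cong zero    h = h 0 z≤n
  sumTo-cong (suc n) h = +-cong (sumTo-cong n (λ i p → h i (NP.m≤n⇒m≤1+n p))) (h (suc n) NP.≤-refl)

  sumTo-+ : ∀ n (f g : ℕ → Carrier) → sumTo n (λ i → f i + g i) ≈ sumTo n f + sumTo n g
  sumTo-+ zero    f g = refl
  sumTo-+ (suc n) f g = trans (+-congʳ (sumTo-+ n f g)) (A+.interchange _ _ _ _)

  sumTo-*ˡ : ∀ n (u : Carrier) (f : ℕ → Carrier) → sumTo n (λ i → u * f i) ≈ u * sumTo n f
  sumTo-*ˡ zero    u f = refl
  sumTo-*ˡ (suc n) u f = trans (+-congʳ (sumTo-*ˡ n u f)) (sym (distribˡ u _ _))

  sumTo-head : ∀ n (f : ℕ → Carrier) → sumTo (suc n) f ≈ f 0 + sumTo n (λ i → f (suc i))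
  sumTo-head zero    f = refl
  sumTo-head (suc n) f = trans (+-congʳ (sumTo-head n f)) (+-assoc _ _ _)

  C-vanish : ∀ n j (u : Carrier) → n N.< j → (n C j) × u ≈ 0#
  C-vanish n j u n<j = trans (reflexive (PE.cong (_× u) (NC.k>n⇒nCk≡0 n<j))) (×-homo-0 u)

  -- The shift D f = f(· + 1) is differentiation on exponential generating
  -- series; the Leibniz rule for it drives all inductions on ⊛ below.
  D : (ℕ → Carrier) → (ℕ → Carrier)
  D f i = f (suc i)

  ⊛-cong : ∀ {f f' g g' : ℕ → Carrier} → (∀ i → f i ≈ f' i) → (∀ i → g i ≈ g' i) →
           ∀ n → (f ⊛ g) n ≈ (f' ⊛ g') n
  ⊛-cong hf hg n = sumTo-cong n (λ i _ → ×-congʳ (n C i) (*-cong (hf i) (hg (n ∸ i))))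

  ⊛-distribˡ : ∀ (f g h : ℕ → Carrier) n → (f ⊛ (λ i → g i + h i)) n ≈ (f ⊛ g) n + (f ⊛ h) n
  ⊛-distribˡ f g h n =
    trans (sumTo-cong n (λ i _ → trans (×-congʳ (n C i) (distribˡ _ _ _)) (×-distrib-+ _ _ (n C i))))
          (sumTo-+ n _ _)

  ⊛-distribʳ : ∀ (f g h : ℕ → Carrier) n → ((λ i → f i + g i) ⊛ h) n ≈ (f ⊛ h) n + (g ⊛ h) n
  ⊛-distribʳ f g h n =
    trans (sumTo-cong n (λ i _ → trans (×-congʳ (n C i) (distribʳ _ _ _)) (×-distrib-+ _ _ (n C i))))
          (sumTo-+ n _ _)

  ⊛-zero : ∀ (f g : ℕ → Carrier) → (f ⊛ g) 0 ≈ f 0 * g 0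
  ⊛-zero f g = ×-homo-1 _

  -- Reindexing i ↦ i+1 identifies the "upper Pascal half" of (f ⊛ g)(n+1),
  -- together with its i = 0 term, with (f ⊛ D g)(n).
  ⊛-Dʳ-reindex : ∀ (f g : ℕ → Carrier) n →
    f 0 * g (suc n) + sumTo n (λ i → (n C suc i) × (f (suc i) * g (n ∸ i))) ≈ (f ⊛ D g) n
  ⊛-Dʳ-reindex f g n = begin
      f 0 * g (suc n) + sumTo n (λ i → (n C suc i) × (f (suc i) * g (n ∸ i)))
    ≈⟨ +-cong (sym (×-homo-1 _)) (sumTo-cong n shifted) ⟩
      h 0 + sumTo n (λ i → h (suc i))
    ≈⟨ sym (sumTo-head n h) ⟩
      sumTo n h + h (suc n)
    ≈⟨ +-congˡ (C-vanish n (suc n) _ (NP.n<1+n n)) ⟩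
      sumTo n h + 0#
    ≈⟨ +-identityʳ _ ⟩
      (f ⊛ D g) n
    ∎
    where
    h : ℕ → Carrier
    h i = (n C i) × (f i * g (suc (n ∸ i)))
    -- for i < n this is n ∸ i = suc (n ∸ suc i); for i ≥ n both sides vanish
    shifted : ∀ i → i N.≤ n → (n C suc i) × (f (suc i) * g (n ∸ i)) ≈ h (suc i)
    shifted i _ with suc i N.≤? n
    ... | yes i<n = ×-congʳ (n C suc i) (*-congˡ (reflexive (PE.cong g (NP.+-∸-assoc 1 i<n))))
    ... | no  i≮n = trans (C-vanish n (suc i) _ n<1+i) (sym (C-vanish n (suc i) _ n<1+i))
      where n<1+i = s≤s (NP.≮⇒≥ i≮n)

  -- Leibniz rule  D(f·g) = Df·g + f·Dg , from Pascal's rule.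
  leibniz : ∀ (f g : ℕ → Carrier) n → (f ⊛ g) (suc n) ≈ (D f ⊛ g) n + (f ⊛ D g) n
  leibniz f g n = begin
      (f ⊛ g) (suc n)
    ≈⟨ sumTo-head n _ ⟩
      1 × (f 0 * g (suc n)) + sumTo n (λ i → (suc n C suc i) × term i)
    ≈⟨ +-cong (×-homo-1 _) (sumTo-cong n (λ i _ → pascal i)) ⟩
      f 0 * g (suc n) + sumTo n (λ i → (n C i) × term i + (n C suc i) × term i)
    ≈⟨ +-congˡ (sumTo-+ n _ _) ⟩
      f 0 * g (suc n) + ((D f ⊛ g) n + upper)
    ≈⟨ A+.x∙yz≈y∙xz _ _ _ ⟩
      (D f ⊛ g) n + (f 0 * g (suc n) + upper)
    ≈⟨ +-congˡ (⊛-Dʳ-reindex f g n) ⟩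
      (D f ⊛ g) n + (f ⊛ D g) n
    ∎
    where
    term : ℕ → Carrier
    term i = f (suc i) * g (n ∸ i)
    upper = sumTo n (λ i → (n C suc i) × term i)
    pascal : ∀ i → (suc n C suc i) × term i ≈ (n C i) × term i + (n C suc i) × term i
    pascal i = trans (reflexive (PE.cong (_× term i) (PE.sym (NC.nCk+nC[k+1]≡[n+1]C[k+1] n i))))
                     (×-homo-+ _ (n C i) (n C suc i))

  ⊛-comm : ∀ n (f g : ℕ → Carrier) → (f ⊛ g) n ≈ (g ⊛ f) n
  ⊛-comm zero f g = trans (⊛-zero f g) (trans (*-comm _ _) (sym (⊛-zero g f)))
  ⊛-comm (suc n) f g = begin
      (f ⊛ g) (suc n)
    ≈⟨ leibniz f g n ⟩
      (D f ⊛ g) n + (f ⊛ D g) n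
    ≈⟨ +-cong (⊛-comm n (D f) g) (⊛-comm n f (D g)) ⟩
      (g ⊛ D f) n + (D g ⊛ f) n
    ≈⟨ +-comm _ _ ⟩
      (D g ⊛ f) n + (g ⊛ D f) n
    ≈⟨ sym (leibniz g f n) ⟩
      (g ⊛ f) (suc n)
    ∎

  ⊛-assoc : ∀ n (f g h : ℕ → Carrier) → ((f ⊛ g) ⊛ h) n ≈ (f ⊛ (g ⊛ h)) n
  ⊛-assoc zero f g h = begin
      ((f ⊛ g) ⊛ h) 0   ≈⟨ trans (⊛-zero (f ⊛ g) h) (*-congʳ (⊛-zero f g)) ⟩
      (f 0 * g 0) * h 0 ≈⟨ *-assoc _ _ _ ⟩
      f 0 * (g 0 * h 0) ≈⟨ sym (trans (⊛-zero f (g ⊛ h)) (*-congˡ (⊛-zero g h))) ⟩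
      (f ⊛ (g ⊛ h)) 0   ∎
  ⊛-assoc (suc n) f g h = begin
      ((f ⊛ g) ⊛ h) (suc n)
    ≈⟨ leibniz (f ⊛ g) h n ⟩
      (D (f ⊛ g) ⊛ h) n + ((f ⊛ g) ⊛ D h) n
    ≈⟨ +-congʳ (⊛-cong {g = h} (leibniz f g) (λ _ → refl) n) ⟩
      ((λ i → (D f ⊛ g) i + (f ⊛ D g) i) ⊛ h) n + ((f ⊛ g) ⊛ D h) n
    ≈⟨ +-congʳ (⊛-distribʳ _ _ h n) ⟩
      (((D f ⊛ g) ⊛ h) n + ((f ⊛ D g) ⊛ h) n) + ((f ⊛ g) ⊛ D h) n
    ≈⟨ +-cong (+-cong (⊛-assoc n (D f) g h) (⊛-assoc n f (D g) h)) (⊛-assoc n f g (D h)) ⟩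
      ((D f ⊛ (g ⊛ h)) n + (f ⊛ (D g ⊛ h)) n) + (f ⊛ (g ⊛ D h)) n
    ≈⟨ +-assoc _ _ _ ⟩
      (D f ⊛ (g ⊛ h)) n + ((f ⊛ (D g ⊛ h)) n + (f ⊛ (g ⊛ D h)) n)
    ≈⟨ +-congˡ (sym (⊛-distribˡ f (D g ⊛ h) (g ⊛ D h) n)) ⟩
      (D f ⊛ (g ⊛ h)) n + (f ⊛ (λ i → (D g ⊛ h) i + (g ⊛ D h) i)) n
    ≈⟨ +-congˡ (⊛-cong {f = f} (λ _ → refl) (λ i → sym (leibniz g h i)) n) ⟩
      (D f ⊛ (g ⊛ h)) n + (f ⊛ D (g ⊛ h)) n
    ≈⟨ sym (leibniz f (g ⊛ h) n) ⟩
      (f ⊛ (g ⊛ h)) (suc n)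
    ∎

  1^ : ∀ m → 1# ^ m ≈ 1#
  1^ zero    = refl
  1^ (suc m) = trans (*-identityˡ _) (1^ m)

  powDiv-cong : ∀ {g g' : ℕ → Carrier} → (∀ i → g i ≈ g' i) → ∀ m n → powDiv g m n ≈ powDiv g' m n
  powDiv-cong hg zero    zero    = refl
  powDiv-cong hg zero    (suc n) = refl
  powDiv-cong hg (suc m) zero    = refl
  powDiv-cong hg (suc m) (suc n) =
    sumTo-cong n (λ j _ → ×-congʳ (n C j) (*-cong (hg (suc j)) (powDiv-cong hg m (n ∸ j))))

  -- Substitution t ↦ b t:  the n-th coefficient of g(bt)^m/m! is b^n times
  -- that of g(t)^m/m!.
  powDiv-scale : ∀ (b : Carrier) (g : ℕ → Carrier) m n →
    powDiv (λ i → b ^ i * g i) m n ≈ b ^ n * powDiv g m n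
  powDiv-scale b g zero    zero    = sym (*-identityˡ _)
  powDiv-scale b g zero    (suc n) = sym (zeroʳ _)
  powDiv-scale b g (suc m) zero    = sym (zeroʳ _)
  powDiv-scale b g (suc m) (suc n) = trans (sumTo-cong n scaled) (sumTo-*ˡ n _ _)
    where
    scaled : ∀ j → j N.≤ n →
      (n C j) × ((b ^ suc j * g (suc j)) * powDiv (λ i → b ^ i * g i) m (n ∸ j))
        ≈ b ^ suc n * ((n C j) × (g (suc j) * powDiv g m (n ∸ j)))
    scaled j j≤n = trans (×-congʳ (n C j) inner) (sym (×-comm-* (n C j) _ _))
      where
      inner = begin
          (b ^ suc j * g (suc j)) * powDiv (λ i → b ^ i * g i) m (n ∸ j)
        ≈⟨ *-congˡ (powDiv-scale b g m (n ∸ j)) ⟩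
          (b ^ suc j * g (suc j)) * (b ^ (n ∸ j) * powDiv g m (n ∸ j))
        ≈⟨ A*.interchange _ _ _ _ ⟩
          (b ^ suc j * b ^ (n ∸ j)) * (g (suc j) * powDiv g m (n ∸ j))
        ≈⟨ *-congʳ (trans (sym (^-homo-* b (suc j) (n ∸ j))) (^-congʳ b (NP.m+[n∸m]≡n (s≤s j≤n)))) ⟩
          b ^ suc n * (g (suc j) * powDiv g m (n ∸ j))
        ∎

  compose-scale : ∀ (b : Carrier) (f g : ℕ → Carrier) n →
    compose f (λ i → b ^ i * g i) n ≈ b ^ n * compose f g n
  compose-scale b f g n =
    trans (sumTo-cong n (λ m _ → trans (*-congˡ (powDiv-scale b g m n)) (A*.x∙yz≈y∙xz _ _ _)))
          (sumTo-*ˡ n _ _)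

  logSeries-scale : ∀ (b : Carrier) i → logSeries b i ≈ b ^ i * logSeries 1# i
  logSeries-scale b zero    = sym (zeroʳ _)
  logSeries-scale b (suc i) = begin
      s * (ι (i N.!) * b ^ suc i)   ≈⟨ sym (*-assoc _ _ _) ⟩
      (s * ι (i N.!)) * b ^ suc i   ≈⟨ *-comm _ _ ⟩
      b ^ suc i * (s * ι (i N.!))   ≈⟨ *-congˡ (*-congˡ (sym (trans (*-congˡ (1^ (suc i))) (*-identityʳ _)))) ⟩
      b ^ suc i * (s * (ι (i N.!) * 1# ^ suc i))
    ∎
    where s = (- 1#) ^ i

  inv-pow : ∀ (a : Carrier) → ¬ (a ≈ 0#) → ∀ m → (a ⁻¹) ^ m ≈ (a ^ m) ⁻¹
  inv-pow a a≉0 m = begin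
      (a ⁻¹) ^ m                                 ≈⟨ sym (*-identityʳ _) ⟩
      (a ⁻¹) ^ m * 1#                            ≈⟨ *-congˡ (sym (inverse (a ^ m) aᵐ≉0)) ⟩
      (a ⁻¹) ^ m * (a ^ m * (a ^ m) ⁻¹)          ≈⟨ sym (*-assoc _ _ _) ⟩
      ((a ⁻¹) ^ m * a ^ m) * (a ^ m) ⁻¹          ≈⟨ *-congʳ (trans (*-comm _ _) aᵐ·a⁻ᵐ≈1) ⟩
      1# * (a ^ m) ⁻¹                            ≈⟨ *-identityˡ _ ⟩
      (a ^ m) ⁻¹                                 ∎
    where
    aᵐ·a⁻ᵐ≈1 : a ^ m * (a ⁻¹) ^ m ≈ 1#
    aᵐ·a⁻ᵐ≈1 = trans (sym (^-distrib-* a (a ⁻¹) m)) (trans (^-congˡ m (inverse a a≉0)) (1^ m))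
    -- 1 ≠ 0 by characteristic zero, so a^m has an inverse and is nonzero
    aᵐ≉0 : ¬ (a ^ m ≈ 0#)
    aᵐ≉0 e = char0 0 (trans (+-identityʳ 1#)
               (trans (sym aᵐ·a⁻ᵐ≈1) (trans (*-congʳ e) (zeroˡ _))))

  lif-log-coefficient : ∀ (k : ℤ) (a : Carrier) → ¬ (a ≈ 0#) → ∀ m →
    compose (lif k) (logSeries (a ⁻¹)) m ≈ polyCauchy k m * (a ^ m) ⁻¹
  lif-log-coefficient k a a≉0 m = begin
      compose (lif k) (logSeries (a ⁻¹)) m
    ≈⟨ sumTo-cong m (λ j _ → *-congˡ (powDiv-cong (logSeries-scale (a ⁻¹)) j m)) ⟩
      compose (lif k) (λ i → (a ⁻¹) ^ i * logSeries 1# i) m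
    ≈⟨ compose-scale (a ⁻¹) (lif k) (logSeries 1#) m ⟩
      (a ⁻¹) ^ m * polyCauchy k m
    ≈⟨ trans (*-comm _ _) (*-congˡ (inv-pow a a≉0 m)) ⟩
      polyCauchy k m * (a ^ m) ⁻¹
    ∎

  pc-expansion : (k : ℤ) (a : Carrier) → ¬ (a ≈ 0#) → (x : Carrier) (n : ℕ) →
       PC k x a n ≈
         sumTo n (λ l → (n C l) × ((polyCauchy k (n ∸ l) * ((a ^ (n ∸ l)) ⁻¹)) * poissonCharlier (- x) a l))
  pc-expansion k a a≉0 x n = begin
      (expNeg ⊛ (L ⊛ B)) n
    ≈⟨ ⊛-cong (λ _ → refl) (λ i → ⊛-comm i L B) n ⟩
      (expNeg ⊛ (B ⊛ L)) n
    ≈⟨ sym (⊛-assoc n expNeg B L) ⟩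
      (poissonCharlier (- x) a ⊛ L) n
    ≈⟨ sumTo-cong n (λ l _ → ×-congʳ (n C l) (trans (*-comm _ _) (*-congʳ (lif-log-coefficient k a a≉0 (n ∸ l))))) ⟩
      sumTo n (λ l → (n C l) × ((polyCauchy k (n ∸ l) * ((a ^ (n ∸ l)) ⁻¹)) * poissonCharlier (- x) a l))
    ∎
    where
    L = compose (lif k) (logSeries (a ⁻¹))
    B = binomSeries (- x) (a ⁻¹)

proposition2 : ∀ {c ℓ} (F : Char0Field c ℓ) →
    let open Char0Field F
        open Series F
    in (k : ℤ) (a : Carrier) → ¬ (a ≈ 0#) → (x : Carrier) (n : ℕ) →
       PC k x a n ≈
         sumTo n (λ l → (n C l) × ((polyCauchy k (n ∸ l) * ((a ^ (n ∸ l)) ⁻¹)) * poissonCharlier (- x) a l))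
proposition2 = pc-expansion
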